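{- Let $\tau_3(n)$ be the number of standard Young tableaux with $n$ cells and at most three columns. For integers $n\ge0$, $i\ge0$ let $\beta_{n,i}$ be the number of standard Young tableaux with $n$ cells whose shape is $(n-i-2k,\,i+k,\,k)$ for some integer $k\ge0$, and let $r_{n,i}$ be the number of standard Young tableaux of shape $\left(\frac{n+i-2}{3},\frac{n+i-2}{3},\frac{n-2i+1}{3}\right)$ if $n-2i\equiv 2\pmod 3$ and $r_{n,i}=0$ otherwise. Put $R(n)=\sum_{i=0}^{\lfloor n/2\rfloor} r_{n,i}$. Then for every $n\ge 3$, $$\tau_3(n)=3\tau_3(n-1)-R(n)-E(n-1)\,C_{\frac{n-1}{2}}-\beta_{n-1,0},$$ where $C_m=\frac{1}{m+1}\binom{2m}{m}$ is the $m$-th Catalan number and $E(m)=1$ if $m$ is even, $E(m)=0$ otherwise.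
   Context: The shape of a standard Young tableau is written as the list of its column lengths $(c_1,c_2,c_3)$ with $c_1\ge c_2\ge c_3\ge 0$ (zero entries meaning absent columns). The number of standard Young tableaux of a list that is not a valid (weakly decreasing, nonnegative) shape is taken to be $0$. -}

module Defs where

open import Data.Nat as ℕ using (ℕ; zero; suc; _≤_; _≤?_)
import Data.Nat.DivMod
open import Data.Nat.Combinatorics using (_C_)
open import Data.Integer as ℤ using (ℤ; +_; -[1+_])
open import Data.Integer.DivMod using (_/ℕ_; _%ℕ_)
open import Data.Fin using (Fin; zero; suc)
open import Data.List using (List; []; _∷_; concatMap; length; filter; upTo; map)
open import Data.Nat.ListAction using (sum)
open import Data.Product using (_×_; _,_)
open import Data.Bool using (Bool; true; false; _∧_; if_then_else_)
open import Relation.Nullary.Decidable using (⌊_⌋; yes; no)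

-- A shape with at most three columns, recorded by its column lengths (c1 , c2 , c3).
Shape : Set
Shape = ℕ × ℕ × ℕ

validShape : Shape → Bool
validShape (a , b , c) = ⌊ c ≤? b ⌋ ∧ ⌊ b ≤? a ⌋

addCell : Fin 3 → Shape → Shape
addCell zero (a , b , c) = (suc a , b , c)
addCell (suc zero) (a , b , c) = (a , suc b , c)
addCell (suc (suc zero)) (a , b , c) = (a , b , suc c)

shapeEq : Shape → Shape → Bool
shapeEq (a , b , c) (a' , b' , c') = ⌊ a ℕ.≟ a' ⌋ ∧ (⌊ b ℕ.≟ b' ⌋ ∧ ⌊ c ℕ.≟ c' ⌋)

-- A standard Young tableau with at most three columns and entries 1..n is
-- encoded by its column word w = w_1 … w_n, where w_j ∈ {0,1,2} is the column
-- containing the entry j.  A word encodes a standard tableau iff after placing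
-- each of the entries 1..j the occupied cells form a (valid) shape.
-- 'runWord s w' checks that all intermediate shapes are valid and returns
-- the final shape check against the target.
standardFrom : Shape → List (Fin 3) → Shape → Bool
standardFrom s [] target = shapeEq s target
standardFrom s (x ∷ w) target =
  validShape (addCell x s) ∧ standardFrom (addCell x s) w target

words : ℕ → List (List (Fin 3))
words zero = [] ∷ []
words (suc n) =
  concatMap (λ w → (zero ∷ w) ∷ (suc zero ∷ w) ∷ (suc (suc zero) ∷ w) ∷ []) (words n)

count : {A : Set} → (A → Bool) → List A → ℕ
count p [] = 0
count p (x ∷ xs) = if p x then suc (count p xs) else count p xs

-- number of standard Young tableaux of the shape with column lengths (a , b , c);
-- it is 0 when (a , b , c) is not weakly decreasing.
syt : ℕ → ℕ → ℕ → ℕ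
syt a b c = count (λ w → standardFrom (0 , 0 , 0) w (a , b , c)) (words (a ℕ.+ b ℕ.+ c))

sytℤ : ℤ → ℤ → ℤ → ℕ
sytℤ (+ a) (+ b) (+ c) = syt a b c
sytℤ _ _ _ = 0

Σ≤ : ℕ → (ℕ → ℕ) → ℕ
Σ≤ n f = sum (map f (upTo (suc n)))

τ₃ : ℕ → ℕ
τ₃ n = Σ≤ n λ a → Σ≤ n λ b → Σ≤ n λ c →
  if ⌊ (a ℕ.+ b ℕ.+ c) ℕ.≟ n ⌋ then syt a b c else 0

-- β_{n,i}: number of SYT with n cells of shape (n-i-2k, i+k, k) for some k ≥ 0.
-- For k > n the first entry is negative, so summing k = 0..n suffices.
β : ℕ → ℕ → ℕ
β n i = Σ≤ n λ k → sytℤ (+ n ℤ.- + i ℤ.- + (2 ℕ.* k)) (+ (i ℕ.+ k)) (+ k)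

r : ℕ → ℕ → ℕ
r n i with ((+ n ℤ.- + (2 ℕ.* i)) %ℕ 3) ℕ.≟ 2
... | yes _ = sytℤ ((+ n ℤ.+ + i ℤ.- + 2) /ℕ 3) ((+ n ℤ.+ + i ℤ.- + 2) /ℕ 3)
                   ((+ n ℤ.- + (2 ℕ.* i) ℤ.+ + 1) /ℕ 3)
... | no _ = 0

R : ℕ → ℕ
R n = Σ≤ (n ℕ./ 2) (r n)

catalan : ℕ → ℕ
catalan m = ((2 ℕ.* m) C m) ℕ./ suc m

E : ℕ → ℕ
E m = if ⌊ (m ℕ.% 2) ℕ.≟ 0 ⌋ then 1 else 0

-- A standard tableau with at most three columns is a walk from the empty shape that adds a cell to
-- one of the three columns at each step and passes only through shapes, so every count in the
-- recurrence is a weighted count of walks.  At a shape (c₁ , c₂ , c₃) column 1 can always grow,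
-- column 2 exactly when c₁ ≠ c₂ and column 3 exactly when c₂ ≠ c₃; summing over the walks with
-- n - 1 steps gives  τ₃(n) = 3 τ₃(n - 1) - #{ends with c₁ = c₂} - #{ends with c₂ = c₃}.
-- The walks ending with c₂ = c₃, at (n - 1 - 2k , k , k), are counted by β_{n-1,0}.  Those ending
-- at (a , a , c) with c ≥ 1 are counted by r_{n,i} with i = a - c + 1, and those ending at
-- (a , a , 0), which exist only for n - 1 = 2a, number C_a by the ballot recursion.

module Submission where

open import Defs

module Recurrence where

  open import Data.Nat
  open import Data.Nat.Properties
  open import Data.Nat.DivMod
  open import Data.Nat.Combinatorics using (_C_; nCk+nC[k+1]≡[n+1]C[k+1]; k>n⇒nCk≡0; nC1≡n; nCk≡nC[n∸k])
  open import Data.Nat.Solver using (module +-*-Solver)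
  open +-*-Solver using (solve; _:+_; _:*_; _:=_; con)
  open import Data.Integer as ℤ using (_⊖_)
  open import Data.Integer.DivMod using (_/ℕ_; _%ℕ_)
  import Data.Integer.Properties as ℤ
  open import Data.Fin using (Fin; zero; suc)
  open import Data.List using (List; []; _∷_; _++_; concatMap; map; applyUpTo)
  open import Data.Nat.ListAction using (sum)
  open import Data.Product using (_×_; _,_; proj₁; proj₂)
  open import Data.Sum using (inj₁; inj₂)
  open import Function using (_∘_)
  open import Data.Bool using (Bool; true; false; _∧_; if_then_else_)
  open import Data.Bool.Properties using (∧-identityʳ)
  open import Data.Empty using (⊥-elim)
  open import Relation.Nullary using (¬_)
  open import Relation.Nullary.Decidable using (Dec; ⌊_⌋; yes; no; dec-true; dec-false; isYes≗does)
  open import Relation.Binary.PropositionalEquality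
    using (_≡_; _≢_; refl; sym; trans; cong; cong₂; subst; module ≡-Reasoning)

  sumBelow : (ℕ → ℕ) → ℕ → ℕ
  sumBelow f zero = 0
  sumBelow f (suc n) = f 0 + sumBelow (λ i → f (suc i)) n

  sum-map-applyUpTo : ∀ (f g : ℕ → ℕ) n → sum (map f (applyUpTo g n)) ≡ sumBelow (λ i → f (g i)) n
  sum-map-applyUpTo f g zero = refl
  sum-map-applyUpTo f g (suc n) = cong (f (g 0) +_) (sum-map-applyUpTo f (λ i → g (suc i)) n)

  Σ≤≡sumBelow : ∀ n f → Σ≤ n f ≡ sumBelow f (suc n)
  Σ≤≡sumBelow n f = sum-map-applyUpTo f (λ i → i) (suc n)

  sumBelow-cong : ∀ n {f g : ℕ → ℕ} → (∀ i → i < n → f i ≡ g i) → sumBelow f n ≡ sumBelow g n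
  sumBelow-cong zero eq = refl
  sumBelow-cong (suc n) eq = cong₂ _+_ (eq 0 z<s) (sumBelow-cong n (λ i i<n → eq (suc i) (s<s i<n)))

  sumBelow-zero : ∀ n {f : ℕ → ℕ} → (∀ i → f i ≡ 0) → sumBelow f n ≡ 0
  sumBelow-zero zero f≡0 = refl
  sumBelow-zero (suc n) f≡0 = cong₂ _+_ (f≡0 0) (sumBelow-zero n (λ i → f≡0 (suc i)))

  sumBelow-single : ∀ n y {f : ℕ → ℕ} → y < n → (∀ i → i ≢ y → f i ≡ 0) → sumBelow f n ≡ f y
  sumBelow-single (suc n) zero {f} _ f≡0 =
    trans (cong (f 0 +_) (sumBelow-zero n (λ i → f≡0 (suc i) (λ ())))) (+-identityʳ (f 0))
  sumBelow-single (suc n) (suc y) {f} (s<s y<n) f≡0 = trans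
    (cong (_+ sumBelow (λ i → f (suc i)) n) (f≡0 0 (λ ())))
    (sumBelow-single n y y<n (λ i i≢y → f≡0 (suc i) (λ e → i≢y (suc-injective e))))

  isYes-true : ∀ {A : Set} (a? : Dec A) → A → ⌊ a? ⌋ ≡ true
  isYes-true a? a = trans (isYes≗does a?) (dec-true a? a)

  isYes-false : ∀ {A : Set} (a? : Dec A) → ¬ A → ⌊ a? ⌋ ≡ false
  isYes-false a? ¬a = trans (isYes≗does a?) (dec-false a? ¬a)

  iverson : Bool → ℕ → ℕ
  iverson b x = if b then x else 0

  iverson-0 : ∀ b → iverson b 0 ≡ 0
  iverson-0 true = refl
  iverson-0 false = refl

  iverson-+ : ∀ b x y → iverson b (x + y) ≡ iverson b x + iverson b y
  iverson-+ true x y = refl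
  iverson-+ false x y = refl

  iverson-* : ∀ b k x → iverson b (k * x) ≡ k * iverson b x
  iverson-* true k x = refl
  iverson-* false k x = sym (*-zeroʳ k)

  count-∷ : ∀ {A : Set} (p : A → Bool) x xs → count p (x ∷ xs) ≡ iverson (p x) 1 + count p xs
  count-∷ p x xs with p x
  ... | true = refl
  ... | false = refl

  count-++ : ∀ {A : Set} (p : A → Bool) xs ys → count p (xs ++ ys) ≡ count p xs + count p ys
  count-++ p [] ys = refl
  count-++ p (x ∷ xs) ys = begin
    count p (x ∷ xs ++ ys)                        ≡⟨ count-∷ p x (xs ++ ys) ⟩
    iverson (p x) 1 + count p (xs ++ ys)          ≡⟨ cong (iverson (p x) 1 +_) (count-++ p xs ys) ⟩
    iverson (p x) 1 + (count p xs + count p ys)   ≡⟨ sym (+-assoc (iverson (p x) 1) _ _) ⟩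
    iverson (p x) 1 + count p xs + count p ys     ≡⟨ cong (_+ count p ys) (sym (count-∷ p x xs)) ⟩
    count p (x ∷ xs) + count p ys                 ∎
    where open ≡-Reasoning

  count-const-∧ : ∀ {A : Set} b (q : A → Bool) xs → count (λ x → b ∧ q x) xs ≡ iverson b (count q xs)
  count-const-∧ true q xs = refl
  count-const-∧ false q [] = refl
  count-const-∧ false q (x ∷ xs) = count-const-∧ false q xs

  -- Walks through three-column shapes

  ∅ : Shape
  ∅ = (0 , 0 , 0)

  size : Shape → ℕ
  size (a , b , c) = a + b + c

  size-addCell : ∀ x s → size (addCell x s) ≡ suc (size s)
  size-addCell zero (a , b , c) = refl
  size-addCell (suc zero) (a , b , c) = cong (_+ c) (+-suc a b)
  size-addCell (suc (suc zero)) (a , b , c) = +-suc (a + b) c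

  size≡⇒≤ : ∀ x y w {n} → x + y + w ≡ n → x ≤ n × y ≤ n × w ≤ n
  size≡⇒≤ x y w refl =
    ≤-trans (m≤m+n x y) (m≤m+n (x + y) w) , ≤-trans (m≤n+m y x) (m≤m+n (x + y) w) , m≤n+m w (x + y)

  validShape⇒≤ : ∀ {a b c} → validShape (a , b , c) ≡ true → c ≤ b × b ≤ a
  validShape⇒≤ {a} {b} {c} valid with c ≤? b | b ≤? a
  ... | yes c≤b | yes b≤a = c≤b , b≤a

  ≟-suc : ∀ x y → ⌊ suc x ≟ suc y ⌋ ≡ ⌊ x ≟ y ⌋
  ≟-suc x y = trans (isYes≗does (suc x ≟ suc y)) (sym (isYes≗does (x ≟ y)))

  shapeEq⇒≡ : ∀ s t → shapeEq s t ≡ true → s ≡ t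
  shapeEq⇒≡ (a , b , c) (a' , b' , c') eq with a ≟ a' | b ≟ b' | c ≟ c'
  ... | yes refl | yes refl | yes refl = refl

  shapeEq-addCell : ∀ x s t → shapeEq (addCell x s) (addCell x t) ≡ shapeEq s t
  shapeEq-addCell zero (a , b , c) (a' , b' , c') =
    cong (_∧ _) (≟-suc a a')
  shapeEq-addCell (suc zero) (a , b , c) (a' , b' , c') =
    cong (λ e → ⌊ a ≟ a' ⌋ ∧ (e ∧ ⌊ c ≟ c' ⌋)) (≟-suc b b')
  shapeEq-addCell (suc (suc zero)) (a , b , c) (a' , b' , c') =
    cong (λ e → ⌊ a ≟ a' ⌋ ∧ (⌊ b ≟ b' ⌋ ∧ e)) (≟-suc c c')

  δ : Shape → Shape → ℕ
  δ t u = iverson (shapeEq u t) 1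

  δ-refl : ∀ t → δ t t ≡ 1
  δ-refl (a , b , c)
    rewrite ≟-diag (refl {x = a}) | ≟-diag (refl {x = b}) | ≟-diag (refl {x = c}) = refl

  δ-≢ : ∀ t u → u ≢ t → δ t u ≡ 0
  δ-≢ t u u≢t with shapeEq u t in eq
  ... | true = ⊥-elim (u≢t (shapeEq⇒≡ u t eq))
  ... | false = refl

  δ-addCell : ∀ x t u → δ (addCell x t) (addCell x u) ≡ δ t u
  δ-addCell x t u = cong (λ b → iverson b 1) (shapeEq-addCell x u t)

  Σ₃ : (Fin 3 → ℕ) → ℕ
  Σ₃ f = f zero + f (suc zero) + f (suc (suc zero))

  Σ₃-cong : ∀ {f g : Fin 3 → ℕ} → (∀ x → f x ≡ g x) → Σ₃ f ≡ Σ₃ g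
  Σ₃-cong eq = cong₂ _+_ (cong₂ _+_ (eq zero) (eq (suc zero))) (eq (suc (suc zero)))

  Σ₃-+ : ∀ (f g : Fin 3 → ℕ) → Σ₃ (λ x → f x + g x) ≡ Σ₃ f + Σ₃ g
  Σ₃-+ f g =
    solve 6 (λ a b c d e h → a :+ d :+ (b :+ e) :+ (c :+ h) := a :+ b :+ c :+ (d :+ e :+ h)) refl
    (f zero) (f (suc zero)) (f (suc (suc zero))) (g zero) (g (suc zero)) (g (suc (suc zero)))

  Σ₃-* : ∀ k (f : Fin 3 → ℕ) → Σ₃ (λ x → k * f x) ≡ k * Σ₃ f
  Σ₃-* k f = solve 4 (λ k a b c → k :* a :+ k :* b :+ k :* c := k :* (a :+ b :+ c)) refl
    k (f zero) (f (suc zero)) (f (suc (suc zero)))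

  forward : (Shape → ℕ) → Shape → ℕ
  forward g s = Σ₃ λ x → iverson (validShape (addCell x s)) (g (addCell x s))

  -- the sum of g over the endpoints of the n-step walks from s that pass only through shapes
  walkSum : (Shape → ℕ) → Shape → ℕ → ℕ
  walkSum g s zero = g s
  walkSum g s (suc n) = forward (λ u → walkSum g u n) s

  forward-cong : ∀ {f g} s → (∀ u → f u ≡ g u) → forward f s ≡ forward g s
  forward-cong s eq = Σ₃-cong λ x → cong (iverson (validShape (addCell x s))) (eq (addCell x s))

  walkSum-shift : ∀ n s g → walkSum g s (suc n) ≡ walkSum (forward g) s n
  walkSum-shift zero s g = refl
  walkSum-shift (suc n) s g = forward-cong s (λ u → walkSum-shift n u g)

  forward-+ : ∀ s (f g : Shape → ℕ) → forward (λ u → f u + g u) s ≡ forward f s + forward g s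
  forward-+ s f g = trans
    (Σ₃-cong λ x → iverson-+ (validShape (addCell x s)) (f (addCell x s)) (g (addCell x s)))
    (Σ₃-+ (λ x → iverson (validShape (addCell x s)) (f (addCell x s)))
          (λ x → iverson (validShape (addCell x s)) (g (addCell x s))))

  forward-* : ∀ s k (f : Shape → ℕ) → forward (λ u → k * f u) s ≡ k * forward f s
  forward-* s k f = trans
    (Σ₃-cong λ x → iverson-* (validShape (addCell x s)) k (f (addCell x s)))
    (Σ₃-* k (λ x → iverson (validShape (addCell x s)) (f (addCell x s))))

  forward-zero : ∀ s → forward (λ _ → 0) s ≡ 0
  forward-zero s = Σ₃-cong {g = λ _ → 0} λ x → iverson-0 (validShape (addCell x s))

  walkSum-+ : ∀ n s (f g : Shape → ℕ) → walkSum (λ u → f u + g u) s n ≡ walkSum f s n + walkSum g s n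
  walkSum-+ zero s f g = refl
  walkSum-+ (suc n) s f g =
    trans (forward-cong s λ u → walkSum-+ n u f g) (forward-+ s (λ u → walkSum f u n) (λ u → walkSum g u n))

  walkSum-* : ∀ n s k (f : Shape → ℕ) → walkSum (λ u → k * f u) s n ≡ k * walkSum f s n
  walkSum-* zero s k f = refl
  walkSum-* (suc n) s k f =
    trans (forward-cong s λ u → walkSum-* n u k f) (forward-* s k (λ u → walkSum f u n))

  walkSum-zero : ∀ n s → walkSum (λ _ → 0) s n ≡ 0
  walkSum-zero zero s = refl
  walkSum-zero (suc n) s = trans (forward-cong s λ u → walkSum-zero n u) (forward-zero s)

  walkSum-iverson : ∀ n s b (f : Shape → ℕ) →
    iverson b (walkSum f s n) ≡ walkSum (λ u → iverson b (f u)) s n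
  walkSum-iverson n s true f = refl
  walkSum-iverson n s false f = sym (walkSum-zero n s)

  walkSum-sumBelow : ∀ m n s (F : ℕ → Shape → ℕ) →
    sumBelow (λ k → walkSum (F k) s n) m ≡ walkSum (λ u → sumBelow (λ k → F k u) m) s n
  walkSum-sumBelow zero n s F = sym (walkSum-zero n s)
  walkSum-sumBelow (suc m) n s F = trans
    (cong (walkSum (F 0) s n +_) (walkSum-sumBelow m n s (λ k → F (suc k))))
    (sym (walkSum-+ n s (F 0) _))

  walkSum-cong : ∀ n s {f g : Shape → ℕ} → validShape s ≡ true →
    (∀ u → validShape u ≡ true → size u ≡ size s + n → f u ≡ g u) → walkSum f s n ≡ walkSum g s n
  walkSum-cong zero s valid eq = eq s valid (sym (+-identityʳ _))
  walkSum-cong (suc n) s {f} {g} valid eq = Σ₃-cong step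
    where
    step : ∀ x → iverson (validShape (addCell x s)) (walkSum f (addCell x s) n)
               ≡ iverson (validShape (addCell x s)) (walkSum g (addCell x s) n)
    step x with validShape (addCell x s) in valid'
    ... | true = walkSum-cong n (addCell x s) valid' λ u valid-u size-u →
          eq u valid-u (trans size-u (trans (cong (_+ n) (size-addCell x s)) (sym (+-suc (size s) n))))
    ... | false = refl

  -- Tableaux as walks

  extensions : List (Fin 3) → List (List (Fin 3))
  extensions w = (zero ∷ w) ∷ (suc zero ∷ w) ∷ (suc (suc zero) ∷ w) ∷ []

  count-extensions : ∀ (p : List (Fin 3) → Bool) w →
    count p (extensions w) ≡ Σ₃ λ x → iverson (p (x ∷ w)) 1
  count-extensions p w = begin
    count p (extensions w)
      ≡⟨ count-∷ p _ ((suc zero ∷ w) ∷ (suc (suc zero) ∷ w) ∷ []) ⟩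
    i₀ + count p ((suc zero ∷ w) ∷ (suc (suc zero) ∷ w) ∷ [])
      ≡⟨ cong (i₀ +_) (count-∷ p _ ((suc (suc zero) ∷ w) ∷ [])) ⟩
    i₀ + (i₁ + count p ((suc (suc zero) ∷ w) ∷ []))
      ≡⟨ cong (λ k → i₀ + (i₁ + k)) (count-∷ p _ []) ⟩
    i₀ + (i₁ + (i₂ + 0))
      ≡⟨ solve 3 (λ a b c → a :+ (b :+ (c :+ con 0)) := a :+ b :+ c) refl i₀ i₁ i₂ ⟩
    i₀ + i₁ + i₂ ∎
    where
    open ≡-Reasoning
    i₀ = iverson (p (zero ∷ w)) 1
    i₁ = iverson (p (suc zero ∷ w)) 1
    i₂ = iverson (p (suc (suc zero) ∷ w)) 1

  count-words-suc : ∀ (p : List (Fin 3) → Bool) n →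
    count p (words (suc n)) ≡ Σ₃ λ x → count (λ w → p (x ∷ w)) (words n)
  count-words-suc p n = go (words n)
    where
    go : ∀ L → count p (concatMap extensions L) ≡ Σ₃ λ x → count (λ w → p (x ∷ w)) L
    go [] = refl
    go (w ∷ L) = begin
      count p (extensions w ++ concatMap extensions L)
        ≡⟨ count-++ p (extensions w) (concatMap extensions L) ⟩
      count p (extensions w) + count p (concatMap extensions L)
        ≡⟨ cong₂ _+_ (count-extensions p w) (go L) ⟩
      Σ₃ (λ x → iverson (p (x ∷ w)) 1) + Σ₃ (λ x → count (λ w → p (x ∷ w)) L)
        ≡⟨ sym (Σ₃-+ (λ x → iverson (p (x ∷ w)) 1) (λ x → count (λ w → p (x ∷ w)) L)) ⟩
      Σ₃ (λ x → iverson (p (x ∷ w)) 1 + count (λ w → p (x ∷ w)) L)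
        ≡⟨ Σ₃-cong (λ x → sym (count-∷ (λ w → p (x ∷ w)) w L)) ⟩
      Σ₃ (λ x → count (λ w → p (x ∷ w)) (w ∷ L)) ∎
      where open ≡-Reasoning

  standardCount : Shape → ℕ → Shape → ℕ
  standardCount s n t = count (λ w → standardFrom s w t) (words n)

  standardCount≡walkSum : ∀ n s t → standardCount s n t ≡ walkSum (δ t) s n
  standardCount≡walkSum zero s t with shapeEq s t
  ... | true = refl
  ... | false = refl
  standardCount≡walkSum (suc n) s t = begin
    standardCount s (suc n) t
      ≡⟨ count-words-suc (λ w → standardFrom s w t) n ⟩
    Σ₃ (λ x → count (λ w → validShape (addCell x s) ∧ standardFrom (addCell x s) w t) (words n))
      ≡⟨ Σ₃-cong (λ x →
           count-const-∧ (validShape (addCell x s)) (λ w → standardFrom (addCell x s) w t) (words n)) ⟩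
    forward (λ u → standardCount u n t) s
      ≡⟨ forward-cong s (λ u → standardCount≡walkSum n u t) ⟩
    walkSum (δ t) s (suc n) ∎
    where open ≡-Reasoning

  syt≡walkSum : ∀ a b c → syt a b c ≡ walkSum (δ (a , b , c)) ∅ (a + b + c)
  syt≡walkSum a b c = standardCount≡walkSum (a + b + c) ∅ (a , b , c)

  δ-sumBelow³ : ∀ M x y w → x < M → y < M → w < M →
    sumBelow (λ a → sumBelow (λ b → sumBelow (λ c → δ (a , b , c) (x , y , w)) M) M) M ≡ 1
  δ-sumBelow³ M x y w x<M y<M w<M = begin
    sumBelow (λ a → sumBelow (λ b → sumBelow (λ c → δ (a , b , c) (x , y , w)) M) M) M
      ≡⟨ sumBelow-single M x x<M (λ a a≢x → sumBelow-zero M λ b → sumBelow-zero M λ c →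
           δ-≢ (a , b , c) (x , y , w) λ e → a≢x (sym (cong proj₁ e))) ⟩
    sumBelow (λ b → sumBelow (λ c → δ (x , b , c) (x , y , w)) M) M
      ≡⟨ sumBelow-single M y y<M (λ b b≢y → sumBelow-zero M λ c →
           δ-≢ (x , b , c) (x , y , w) λ e → b≢y (sym (cong (proj₁ ∘ proj₂) e))) ⟩
    sumBelow (λ c → δ (x , y , c) (x , y , w)) M
      ≡⟨ sumBelow-single M w w<M (λ c c≢w →
           δ-≢ (x , y , c) (x , y , w) λ e → c≢w (sym (cong (proj₂ ∘ proj₂) e))) ⟩
    δ (x , y , w) (x , y , w)
      ≡⟨ δ-refl (x , y , w) ⟩
    1 ∎
    where open ≡-Reasoning

  syt-if-size≡walkSum : ∀ n a b c →
    (if ⌊ a + b + c ≟ n ⌋ then syt a b c else 0) ≡ walkSum (δ (a , b , c)) ∅ n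
  syt-if-size≡walkSum n a b c with a + b + c ≟ n
  ... | yes refl = syt≡walkSum a b c
  ... | no size≢n = sym (trans
    (walkSum-cong n ∅ refl λ u _ size-u →
      δ-≢ (a , b , c) u λ u≡t → size≢n (trans (sym (cong size u≡t)) size-u))
    (walkSum-zero n ∅))

  Σ≤-walkSum : ∀ m n s (F : ℕ → Shape → ℕ) {f : ℕ → ℕ} →
    (∀ k → k ≤ m → f k ≡ walkSum (F k) s n) →
    Σ≤ m f ≡ walkSum (λ u → sumBelow (λ k → F k u) (suc m)) s n
  Σ≤-walkSum m n s F {f} eq = begin
    Σ≤ m f
      ≡⟨ Σ≤≡sumBelow m f ⟩
    sumBelow f (suc m)
      ≡⟨ sumBelow-cong (suc m) (λ k k<1+m → eq k (≤-pred k<1+m)) ⟩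
    sumBelow (λ k → walkSum (F k) s n) (suc m)
      ≡⟨ walkSum-sumBelow (suc m) n s F ⟩
    walkSum (λ u → sumBelow (λ k → F k u) (suc m)) s n ∎
    where open ≡-Reasoning

  τ₃≡walkSum : ∀ n → τ₃ n ≡ walkSum (λ _ → 1) ∅ n
  τ₃≡walkSum n = begin
    τ₃ n                  ≡⟨ Σ≤-walkSum n n ∅ Δ₁ (λ a _ → columns a) ⟩
    walkSum Δ₀ ∅ n        ≡⟨ walkSum-cong n ∅ refl (λ { (x , y , w) _ size≡n → Δ₀≡1 x y w size≡n }) ⟩
    walkSum (λ _ → 1) ∅ n ∎
    where
    open ≡-Reasoning
    N = suc n
    Δ₂ : ℕ → ℕ → Shape → ℕ
    Δ₂ a b u = sumBelow (λ c → δ (a , b , c) u) N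
    Δ₁ : ℕ → Shape → ℕ
    Δ₁ a u = sumBelow (λ b → Δ₂ a b u) N
    Δ₀ : Shape → ℕ
    Δ₀ u = sumBelow (λ a → Δ₁ a u) N
    columns : ∀ a →
      Σ≤ n (λ b → Σ≤ n λ c → if ⌊ a + b + c ≟ n ⌋ then syt a b c else 0) ≡ walkSum (Δ₁ a) ∅ n
    columns a = Σ≤-walkSum n n ∅ (Δ₂ a) λ b _ →
                Σ≤-walkSum n n ∅ (λ c → δ (a , b , c)) λ c _ → syt-if-size≡walkSum n a b c
    Δ₀≡1 : ∀ x y w → x + y + w ≡ 0 + n → Δ₀ (x , y , w) ≡ 1
    Δ₀≡1 x y w size≡n =
      let x≤n , y≤n , w≤n = size≡⇒≤ x y w size≡n in δ-sumBelow³ N x y w (s≤s x≤n) (s≤s y≤n) (s≤s w≤n)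

  -- Growable and blocked columns

  col₂Blocked col₃Blocked : Shape → ℕ
  col₂Blocked (a , b , c) = iverson ⌊ a ≟ b ⌋ 1
  col₃Blocked (a , b , c) = iverson ⌊ b ≟ c ⌋ 1

  [y<x]+[x≡y]≡1 : ∀ {x y} → y ≤ x → iverson ⌊ suc y ≤? x ⌋ 1 + iverson ⌊ x ≟ y ⌋ 1 ≡ 1
  [y<x]+[x≡y]≡1 {x} {y} y≤x with m≤n⇒m<n∨m≡n y≤x
  ... | inj₁ y<x
    rewrite isYes-true (suc y ≤? x) y<x | isYes-false (x ≟ y) (λ x≡y → <-irrefl (sym x≡y) y<x) = refl
  ... | inj₂ refl
    rewrite isYes-false (suc y ≤? y) (n≮n y) | ≟-diag (refl {x = y}) = refl

  growable+blocked≡3 : ∀ {a b c} → c ≤ b → b ≤ a →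
    forward (λ _ → 1) (a , b , c) + col₂Blocked (a , b , c) + col₃Blocked (a , b , c) ≡ 3
  growable+blocked≡3 {a} {b} {c} c≤b b≤a
    rewrite isYes-true (c ≤? b) c≤b | isYes-true (b ≤? suc a) (m≤n⇒m≤1+n b≤a)
          | isYes-true (c ≤? suc b) (m≤n⇒m≤1+n c≤b) | isYes-true (b ≤? a) b≤a
          | ∧-identityʳ ⌊ suc c ≤? b ⌋ = begin
    1 + g₂ + g₃ + e₂ + e₃
      ≡⟨ solve 4 (λ p q r s → con 1 :+ p :+ q :+ r :+ s := con 1 :+ (p :+ r) :+ (q :+ s)) refl g₂ g₃ e₂ e₃ ⟩
    1 + (g₂ + e₂) + (g₃ + e₃)
      ≡⟨ cong₂ (λ p q → 1 + p + q) ([y<x]+[x≡y]≡1 b≤a) ([y<x]+[x≡y]≡1 c≤b) ⟩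
    3 ∎
    where
    open ≡-Reasoning
    g₂ = iverson ⌊ suc b ≤? a ⌋ 1
    g₃ = iverson ⌊ suc c ≤? b ⌋ 1
    e₂ = iverson ⌊ a ≟ b ⌋ 1
    e₃ = iverson ⌊ b ≟ c ⌋ 1

  τ₃-suc+blocked≡3τ₃ : ∀ n → τ₃ (suc n) + walkSum col₂Blocked ∅ n + walkSum col₃Blocked ∅ n ≡ 3 * τ₃ n
  τ₃-suc+blocked≡3τ₃ n = begin
    τ₃ (suc n) + walkSum col₂Blocked ∅ n + walkSum col₃Blocked ∅ n
      ≡⟨ cong (λ k → k + walkSum col₂Blocked ∅ n + walkSum col₃Blocked ∅ n)
              (trans (τ₃≡walkSum (suc n)) (walkSum-shift n ∅ (λ _ → 1))) ⟩
    walkSum (forward (λ _ → 1)) ∅ n + walkSum col₂Blocked ∅ n + walkSum col₃Blocked ∅ n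
      ≡⟨ cong (_+ walkSum col₃Blocked ∅ n) (sym (walkSum-+ n ∅ (forward (λ _ → 1)) col₂Blocked)) ⟩
    walkSum (λ u → forward (λ _ → 1) u + col₂Blocked u) ∅ n + walkSum col₃Blocked ∅ n
      ≡⟨ sym (walkSum-+ n ∅ (λ u → forward (λ _ → 1) u + col₂Blocked u) col₃Blocked) ⟩
    walkSum (λ u → forward (λ _ → 1) u + col₂Blocked u + col₃Blocked u) ∅ n
      ≡⟨ walkSum-cong n ∅ refl (λ { (a , b , c) valid _ → let c≤b , b≤a = validShape⇒≤ valid in
           trans (growable+blocked≡3 {a} {b} {c} c≤b b≤a) (sym (*-identityʳ 3)) }) ⟩
    walkSum (λ _ → 3 * 1) ∅ n
      ≡⟨ walkSum-* n ∅ 3 (λ _ → 1) ⟩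
    3 * walkSum (λ _ → 1) ∅ n
      ≡⟨ cong (3 *_) (sym (τ₃≡walkSum n)) ⟩
    3 * τ₃ n ∎
    where open ≡-Reasoning

  -- Walks ending with c₂ = c₃

  sytℤ-⊖ : ∀ m j b c → sytℤ (m ⊖ j) (ℤ.+ b) (ℤ.+ c) ≡ iverson ⌊ j ≤? m ⌋ (syt (m ∸ j) b c)
  sytℤ-⊖ m j b c with j ≤? m
  ... | yes j≤m = cong (λ z → sytℤ z (ℤ.+ b) (ℤ.+ c)) (ℤ.⊖-≥ j≤m)
  ... | no j≰m rewrite ℤ.⊖-< (≰⇒> j≰m) with j ∸ m | m<n⇒0<n∸m (≰⇒> j≰m)
  ...   | suc _ | _ = refl

  βWeight : ℕ → ℕ → Shape → ℕ
  βWeight n k u = iverson ⌊ 2 * k ≤? n ⌋ (δ (n ∸ 2 * k , k , k) u)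

  β-term≡walkSum : ∀ n k →
    sytℤ (ℤ.+ n ℤ.- ℤ.+ 0 ℤ.- ℤ.+ (2 * k)) (ℤ.+ (0 + k)) (ℤ.+ k) ≡ walkSum (βWeight n k) ∅ n
  β-term≡walkSum n k = begin
    sytℤ (ℤ.+ n ℤ.- ℤ.+ 0 ℤ.- ℤ.+ (2 * k)) (ℤ.+ k) (ℤ.+ k)
      ≡⟨ cong (λ z → sytℤ z (ℤ.+ k) (ℤ.+ k))
              (trans (cong (ℤ._- ℤ.+ (2 * k)) (ℤ.+-identityʳ (ℤ.+ n))) (ℤ.m-n≡m⊖n n (2 * k))) ⟩
    sytℤ (n ⊖ 2 * k) (ℤ.+ k) (ℤ.+ k)
      ≡⟨ sytℤ-⊖ n (2 * k) k k ⟩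
    iverson ⌊ 2 * k ≤? n ⌋ (syt (n ∸ 2 * k) k k)
      ≡⟨ syt-term ⟩
    iverson ⌊ 2 * k ≤? n ⌋ (walkSum (δ (n ∸ 2 * k , k , k)) ∅ n)
      ≡⟨ walkSum-iverson n ∅ ⌊ 2 * k ≤? n ⌋ (δ (n ∸ 2 * k , k , k)) ⟩
    walkSum (βWeight n k) ∅ n ∎
    where
    open ≡-Reasoning
    syt-term : iverson ⌊ 2 * k ≤? n ⌋ (syt (n ∸ 2 * k) k k)
             ≡ iverson ⌊ 2 * k ≤? n ⌋ (walkSum (δ (n ∸ 2 * k , k , k)) ∅ n)
    syt-term with 2 * k ≤? n
    ... | no _ = refl
    ... | yes 2k≤n = trans (syt≡walkSum (n ∸ 2 * k) k k) (cong (walkSum (δ (n ∸ 2 * k , k , k)) ∅) size≡n)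
      where
      size≡n : n ∸ 2 * k + k + k ≡ n
      size≡n = trans (+-assoc (n ∸ 2 * k) k k)
                     (trans (cong (λ z → n ∸ 2 * k + (k + z)) (sym (+-identityʳ k))) (m∸n+n≡m 2k≤n))

  βWeight-diagonal : ∀ n x y → x + y + y ≡ n → βWeight n y (x , y , y) ≡ 1
  βWeight-diagonal n x y size≡n = trans
    (cong₂ (λ b z → iverson b (δ (z , y , y) (x , y , y))) (isYes-true (2 * y ≤? n) 2y≤n) n∸2y≡x)
    (δ-refl (x , y , y))
    where
    x+2y≡n : x + 2 * y ≡ n
    x+2y≡n = trans (solve 2 (λ x y → x :+ con 2 :* y := x :+ y :+ y) refl x y) size≡n
    2y≤n : 2 * y ≤ n
    2y≤n = subst (2 * y ≤_) x+2y≡n (m≤n+m (2 * y) x)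
    n∸2y≡x : n ∸ 2 * y ≡ x
    n∸2y≡x = trans (cong (_∸ 2 * y) (sym x+2y≡n)) (m+n∸n≡m x (2 * y))

  sum-βWeight≡col₃Blocked : ∀ n x y w → x + y + w ≡ n →
    sumBelow (λ k → βWeight n k (x , y , w)) (suc n) ≡ col₃Blocked (x , y , w)
  sum-βWeight≡col₃Blocked n x y w size≡n =
    trans (sumBelow-single (suc n) y (s≤s (proj₁ (proj₂ (size≡⇒≤ x y w size≡n)))) others) at-y
    where
    others : ∀ k → k ≢ y → βWeight n k (x , y , w) ≡ 0
    others k k≢y = trans
      (cong (iverson ⌊ 2 * k ≤? n ⌋) (δ-≢ (n ∸ 2 * k , k , k) (x , y , w) λ e → k≢y (sym (cong (proj₁ ∘ proj₂) e))))
      (iverson-0 ⌊ 2 * k ≤? n ⌋)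
    at-y : βWeight n y (x , y , w) ≡ iverson ⌊ y ≟ w ⌋ 1
    at-y with y ≟ w
    ... | yes refl = βWeight-diagonal n x y size≡n
    ... | no y≢w = trans
      (cong (iverson ⌊ 2 * y ≤? n ⌋) (δ-≢ (n ∸ 2 * y , y , y) (x , y , w) λ e → y≢w (sym (cong (proj₂ ∘ proj₂) e))))
      (iverson-0 ⌊ 2 * y ≤? n ⌋)

  β≡walkSum-col₃Blocked : ∀ n → β n 0 ≡ walkSum col₃Blocked ∅ n
  β≡walkSum-col₃Blocked n = begin
    β n 0
      ≡⟨ Σ≤-walkSum n n ∅ (βWeight n) (λ k _ → β-term≡walkSum n k) ⟩
    walkSum (λ u → sumBelow (λ k → βWeight n k u) (suc n)) ∅ n
      ≡⟨ walkSum-cong n ∅ refl (λ { (x , y , w) _ size≡n → sum-βWeight≡col₃Blocked n x y w size≡n }) ⟩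
    walkSum col₃Blocked ∅ n ∎
    where open ≡-Reasoning

  -- Two-column tableaux and the Catalan numbers

  δ-validShape : ∀ s t → iverson (validShape s) (δ t s) ≡ iverson (validShape t) (δ t s)
  δ-validShape s t with shapeEq s t in eq
  ... | true = cong (λ u → iverson (validShape u) 1) (shapeEq⇒≡ s t eq)
  ... | false = trans (iverson-0 (validShape s)) (sym (iverson-0 (validShape t)))

  Σ₃-iverson : ∀ b (f : Fin 3 → ℕ) → Σ₃ (λ x → iverson b (f x)) ≡ iverson b (Σ₃ f)
  Σ₃-iverson true f = refl
  Σ₃-iverson false f = refl

  lastCellWeight : Shape → Shape → ℕ
  lastCellWeight t u = Σ₃ λ x → δ t (addCell x u)

  forward-δ : ∀ t u → forward (δ t) u ≡ iverson (validShape t) (lastCellWeight t u)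
  forward-δ t u = trans
    (Σ₃-cong λ x → δ-validShape (addCell x u) t)
    (Σ₃-iverson (validShape t) (λ x → δ t (addCell x u)))

  syt-lastCell : ∀ a b c K → a + b + c ≡ suc K →
    syt a b c ≡ iverson (validShape (a , b , c)) (walkSum (lastCellWeight (a , b , c)) ∅ K)
  syt-lastCell a b c K size≡1+K = begin
    syt a b c                      ≡⟨ syt≡walkSum a b c ⟩
    walkSum (δ t) ∅ (a + b + c)    ≡⟨ cong (walkSum (δ t) ∅) size≡1+K ⟩
    walkSum (δ t) ∅ (suc K)        ≡⟨ walkSum-shift K ∅ (δ t) ⟩
    walkSum (forward (δ t)) ∅ K    ≡⟨ walkSum-cong K ∅ refl (λ u _ _ → forward-δ t u) ⟩
    walkSum (λ u → iverson (validShape t) (lastCellWeight t u)) ∅ K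
      ≡⟨ sym (walkSum-iverson K ∅ (validShape t) (lastCellWeight t)) ⟩
    iverson (validShape t) (walkSum (lastCellWeight t) ∅ K) ∎
    where
    open ≡-Reasoning
    t = (a , b , c)

  syt-invalid : ∀ a b c K → a + b + c ≡ suc K → validShape (a , b , c) ≡ false → syt a b c ≡ 0
  syt-invalid a b c K size≡1+K invalid = trans
    (syt-lastCell a b c K size≡1+K)
    (cong (λ v → iverson v (walkSum (lastCellWeight (a , b , c)) ∅ K)) invalid)

  syt-oneColumn : ∀ a → syt a 0 0 ≡ 1
  syt-oneColumn zero = refl
  syt-oneColumn (suc a) = begin
    syt (suc a) 0 0
      ≡⟨ syt-lastCell (suc a) 0 0 (a + 0 + 0) refl ⟩
    walkSum (lastCellWeight (suc a , 0 , 0)) ∅ (a + 0 + 0)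
      ≡⟨ walkSum-cong (a + 0 + 0) ∅ refl (λ { (x , y , w) _ _ → lastCell x y w }) ⟩
    walkSum (δ (a , 0 , 0)) ∅ (a + 0 + 0)
      ≡⟨ sym (syt≡walkSum a 0 0) ⟩
    syt a 0 0
      ≡⟨ syt-oneColumn a ⟩
    1 ∎
    where
    open ≡-Reasoning
    lastCell : ∀ x y w → lastCellWeight (suc a , 0 , 0) (x , y , w) ≡ δ (a , 0 , 0) (x , y , w)
    lastCell x y w = begin
      δ (suc a , 0 , 0) (suc x , y , w) + δ (suc a , 0 , 0) (x , suc y , w) + δ (suc a , 0 , 0) (x , y , suc w)
        ≡⟨ cong₂ (λ p q → δ (suc a , 0 , 0) (suc x , y , w) + p + q)
             (δ-≢ (suc a , 0 , 0) (x , suc y , w) λ ()) (δ-≢ (suc a , 0 , 0) (x , y , suc w) λ ()) ⟩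
      δ (suc a , 0 , 0) (suc x , y , w) + 0 + 0
        ≡⟨ trans (+-identityʳ _) (+-identityʳ _) ⟩
      δ (suc a , 0 , 0) (suc x , y , w)
        ≡⟨ δ-addCell zero (a , 0 , 0) (x , y , w) ⟩
      δ (a , 0 , 0) (x , y , w) ∎

  syt-twoColumn-suc : ∀ a b → b ≤ a → syt (suc a) (suc b) 0 ≡ syt a (suc b) 0 + syt (suc a) b 0
  syt-twoColumn-suc a b b≤a = begin
    syt (suc a) (suc b) 0
      ≡⟨ syt-lastCell (suc a) (suc b) 0 K refl ⟩
    iverson (validShape t) (walkSum (lastCellWeight t) ∅ K)
      ≡⟨ cong (λ v → iverson v (walkSum (lastCellWeight t) ∅ K)) valid ⟩
    walkSum (lastCellWeight t) ∅ K
      ≡⟨ walkSum-cong K ∅ refl (λ { (x , y , w) _ _ → lastCell x y w }) ⟩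
    walkSum (λ u → δ (a , suc b , 0) u + δ (suc a , b , 0) u) ∅ K
      ≡⟨ walkSum-+ K ∅ (δ (a , suc b , 0)) (δ (suc a , b , 0)) ⟩
    walkSum (δ (a , suc b , 0)) ∅ K + walkSum (δ (suc a , b , 0)) ∅ K
      ≡⟨ cong₂ _+_ (sym (syt≡walkSum a (suc b) 0))
                   (trans (cong (λ m → walkSum (δ (suc a , b , 0)) ∅ (m + 0)) (+-suc a b))
                          (sym (syt≡walkSum (suc a) b 0))) ⟩
    syt a (suc b) 0 + syt (suc a) b 0 ∎
    where
    open ≡-Reasoning
    t = (suc a , suc b , 0)
    K = a + suc b + 0
    valid : validShape t ≡ true
    valid = cong₂ _∧_ (isYes-true (0 ≤? suc b) z≤n) (isYes-true (suc b ≤? suc a) (s≤s b≤a))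
    lastCell : ∀ x y w →
      lastCellWeight t (x , y , w) ≡ δ (a , suc b , 0) (x , y , w) + δ (suc a , b , 0) (x , y , w)
    lastCell x y w = trans
      (cong₂ _+_ (cong₂ _+_ (δ-addCell zero (a , suc b , 0) (x , y , w))
                            (δ-addCell (suc zero) (suc a , b , 0) (x , y , w)))
                 (δ-≢ t (x , y , suc w) λ ()))
      (+-identityʳ _)

  [1+k]*[1+n]C[1+k]≡[1+n]*nCk : ∀ n k → suc k * (suc n C suc k) ≡ suc n * (n C k)
  [1+k]*[1+n]C[1+k]≡[1+n]*nCk zero zero = refl
  [1+k]*[1+n]C[1+k]≡[1+n]*nCk zero (suc k) = begin
    (2 + k) * (1 C (2 + k))  ≡⟨ cong ((2 + k) *_) (k>n⇒nCk≡0 {1} {2 + k} (s<s z<s)) ⟩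
    (2 + k) * 0              ≡⟨ *-zeroʳ (2 + k) ⟩
    0                        ≡⟨ cong (1 *_) (sym (k>n⇒nCk≡0 {0} {suc k} z<s)) ⟩
    1 * (0 C suc k)          ∎
    where open ≡-Reasoning
  [1+k]*[1+n]C[1+k]≡[1+n]*nCk (suc n) zero =
    trans (*-identityˡ _) (trans (nC1≡n (2 + n)) (sym (*-identityʳ (2 + n))))
  [1+k]*[1+n]C[1+k]≡[1+n]*nCk (suc n) (suc k) = begin
    (2 + k) * ((2 + n) C (2 + k))
      ≡⟨ cong ((2 + k) *_) (sym (nCk+nC[k+1]≡[n+1]C[k+1] (suc n) (suc k))) ⟩
    (2 + k) * (A + B)
      ≡⟨ solve 3 (λ k A B → (con 2 :+ k) :* (A :+ B) := A :+ (con 1 :+ k) :* A :+ (con 2 :+ k) :* B) refl k A B ⟩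
    A + (1 + k) * A + (2 + k) * B
      ≡⟨ cong₂ (λ p q → A + p + q) ([1+k]*[1+n]C[1+k]≡[1+n]*nCk n k) ([1+k]*[1+n]C[1+k]≡[1+n]*nCk n (suc k)) ⟩
    A + (1 + n) * (n C k) + (1 + n) * (n C suc k)
      ≡⟨ trans (+-assoc A _ _) (cong (A +_) (sym (*-distribˡ-+ (1 + n) (n C k) (n C suc k)))) ⟩
    A + (1 + n) * (n C k + n C suc k)
      ≡⟨ cong (λ p → A + (1 + n) * p) (nCk+nC[k+1]≡[n+1]C[k+1] n k) ⟩
    A + (1 + n) * A
      ≡⟨⟩
    (2 + n) * A ∎
    where
    open ≡-Reasoning
    A = (1 + n) C (1 + k)
    B = (1 + n) C (2 + k)

  -- N C (b - 1), without the junk value N C 0 at b = 0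
  C-pred : ℕ → ℕ → ℕ
  C-pred N zero = 0
  C-pred N (suc b) = N C b

  C-pred-suc : ∀ N b → suc N C b ≡ C-pred N b + N C b
  C-pred-suc N zero = refl
  C-pred-suc N (suc b) = sym (nCk+nC[k+1]≡[n+1]C[k+1] N b)

  ballot : ∀ a b → b ≤ suc a → syt a b 0 + C-pred (a + b) b ≡ (a + b) C b
  ballot a zero _ = cong (_+ 0) (syt-oneColumn a)
  ballot a (suc b) b≤1+a with suc b ≤? a
  ballot zero (suc b) _ | yes ()
  ballot (suc a) (suc b) b≤1+a | yes b<1+a = begin
    syt (suc a) (suc b) 0 + C-pred (suc a + suc b) (suc b)
      ≡⟨ cong (_+ C-pred (suc a + suc b) (suc b)) (syt-twoColumn-suc a b (≤-pred b<1+a)) ⟩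
    X + Y + suc N C b
      ≡⟨ cong (X + Y +_) (C-pred-suc N b) ⟩
    X + Y + (C-pred N b + N C b)
      ≡⟨ solve 4 (λ X Y c d → X :+ Y :+ (c :+ d) := (X :+ d) :+ (Y :+ c)) refl X Y (C-pred N b) (N C b) ⟩
    (X + N C b) + (Y + C-pred N b)
      ≡⟨ cong₂ _+_ (ballot a (suc b) (s≤s (≤-pred b<1+a)))
                   (subst (λ M → Y + C-pred M b ≡ M C b) (sym (+-suc a b))
                          (ballot (suc a) b (m≤n⇒m≤1+n (≤-pred b≤1+a)))) ⟩
    N C suc b + N C b
      ≡⟨ trans (+-comm (N C suc b) (N C b)) (nCk+nC[k+1]≡[n+1]C[k+1] N b) ⟩
    suc N C suc b ∎
    where
    open ≡-Reasoning
    X = syt a (suc b) 0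
    Y = syt (suc a) b 0
    N = a + suc b
  ballot a (suc b) b≤1+a | no b≮a = begin
    syt a (suc b) 0 + (a + suc b) C b
      ≡⟨ cong (_+ (a + suc b) C b) (syt-invalid a (suc b) 0 (a + b + 0) (cong (_+ 0) (+-suc a b)) invalid) ⟩
    (a + suc b) C b
      ≡⟨ cong ((a + suc b) C_) b≡a ⟩
    (a + suc b) C a
      ≡⟨ nCk≡nC[n∸k] (m≤m+n a (suc b)) ⟩
    (a + suc b) C (a + suc b ∸ a)
      ≡⟨ cong ((a + suc b) C_) (trans (m+n∸m≡n a (suc b)) (cong suc b≡a)) ⟩
    (a + suc b) C suc a
      ≡⟨ cong (λ k → (a + suc b) C suc k) (sym b≡a) ⟩
    (a + suc b) C suc b ∎
    where
    open ≡-Reasoning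
    invalid : validShape (a , suc b , 0) ≡ false
    invalid = cong (true ∧_) (isYes-false (suc b ≤? a) b≮a)
    b≡a : b ≡ a
    b≡a = ≤-antisym (≤-pred b≤1+a) (≤-pred (≰⇒> b≮a))

  [1+m]*syt[m,m,0]≡[2m]Cm : ∀ m → suc m * syt m m 0 ≡ (m + m) C m
  [1+m]*syt[m,m,0]≡[2m]Cm zero = refl
  [1+m]*syt[m,m,0]≡[2m]Cm (suc k) = +-cancelʳ-≡ ((1 + k) * Y) (suc m * X) Y (begin
    suc m * X + (1 + k) * Y           ≡⟨ cong (suc m * X +_) (sym absorb) ⟩
    suc m * X + (2 + k) * (M C k)     ≡⟨ sym (*-distribˡ-+ (suc m) X (M C k)) ⟩
    suc m * (X + M C k)               ≡⟨ cong (suc m *_) (ballot m m (n≤1+n m)) ⟩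
    Y + (1 + k) * Y                   ∎)
    where
    open ≡-Reasoning
    m = suc k
    M = m + m
    n′ = k + m
    X = syt m m 0
    Y = M C m
    absorb : (2 + k) * (M C k) ≡ (1 + k) * Y
    absorb = begin
      (2 + k) * (M C k)
        ≡⟨ cong ((2 + k) *_) (trans (nCk≡nC[n∸k] (≤-trans (n≤1+n k) (m≤m+n m m)))
                                    (cong (M C_) (trans (cong (_∸ k) (sym (+-suc k m))) (m+n∸m≡n k (2 + k))))) ⟩
      (2 + k) * (M C (2 + k))
        ≡⟨ [1+k]*[1+n]C[1+k]≡[1+n]*nCk n′ (suc k) ⟩
      suc n′ * (n′ C suc k)
        ≡⟨ cong (suc n′ *_) (sym (trans (nCk≡nC[n∸k] (m≤m+n k m)) (cong (n′ C_) (m+n∸m≡n k m)))) ⟩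
      suc n′ * (n′ C k)
        ≡⟨ sym ([1+k]*[1+n]C[1+k]≡[1+n]*nCk n′ k) ⟩
      (1 + k) * Y ∎

  catalan≡syt : ∀ m → catalan m ≡ syt m m 0
  catalan≡syt m = begin
    ((2 * m) C m) / suc m            ≡⟨ cong (λ N → (N C m) / suc m) (cong (m +_) (+-identityʳ m)) ⟩
    ((m + m) C m) / suc m            ≡⟨ cong (_/ suc m) (sym ([1+m]*syt[m,m,0]≡[2m]Cm m)) ⟩
    (suc m * syt m m 0) / suc m      ≡⟨ cong (_/ suc m) (*-comm (suc m) (syt m m 0)) ⟩
    (syt m m 0 * suc m) / suc m      ≡⟨ m*n/n≡m (syt m m 0) (suc m) ⟩
    syt m m 0                        ∎
    where open ≡-Reasoning

  -- Walks ending with c₁ = c₂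

  +m-+j≡+[m∸j] : ∀ {m j} → j ≤ m → ℤ.+ m ℤ.- ℤ.+ j ≡ ℤ.+ (m ∸ j)
  +m-+j≡+[m∸j] {m} {j} j≤m = trans (ℤ.m-n≡m⊖n m j) (ℤ.⊖-≥ j≤m)

  half-≤ : ∀ i m → 2 * i ≤ m → i ≤ m / 2
  half-≤ i m 2i≤m = subst (_≤ m / 2) (trans (cong (_/ 2) (*-comm 2 i)) (m*n/n≡m i 2)) (/-monoˡ-≤ 2 2i≤m)

  ≤-half : ∀ i m → i ≤ m / 2 → 2 * i ≤ m
  ≤-half i m i≤m/2 = ≤-trans (subst (_≤ (m / 2) * 2) (*-comm i 2) (*-monoˡ-≤ 2 i≤m/2)) (m/n*n≤m m 2)

  [2+q*3]/3≡q : ∀ q → (2 + q * 3) / 3 ≡ q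
  [2+q*3]/3≡q q = trans
    (+-distrib-/ 2 (q * 3) (subst (λ k → 2 + k < 3) (sym (m*n%n≡0 q 3)) (s≤s (s≤s (s≤s z≤n)))))
    (m*n/n≡m q 3)

  gap : ℕ → ℕ → ℕ
  gap n i = suc n ∸ 2 * i

  -- the shape of r_{n+1,i}: when gap n i = 3q + 2 it is (q + i , q + i , q + 1)
  rWeight : ℕ → ℕ → Shape → ℕ
  rWeight n i u = iverson ⌊ gap n i % 3 ≟ 2 ⌋ (δ (gap n i / 3 + i , gap n i / 3 + i , gap n i / 3 + 1) u)

  r-unfold : ∀ m i → r m i ≡ iverson ⌊ ((ℤ.+ m ℤ.- ℤ.+ (2 * i)) %ℕ 3) ≟ 2 ⌋
    (sytℤ ((ℤ.+ m ℤ.+ ℤ.+ i ℤ.- ℤ.+ 2) /ℕ 3) ((ℤ.+ m ℤ.+ ℤ.+ i ℤ.- ℤ.+ 2) /ℕ 3)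
          ((ℤ.+ m ℤ.- ℤ.+ (2 * i) ℤ.+ ℤ.+ 1) /ℕ 3))
  r-unfold m i with ((ℤ.+ m ℤ.- ℤ.+ (2 * i)) %ℕ 3) ≟ 2
  ... | yes _ = refl
  ... | no _ = refl

  r≡walkSum-rWeight : ∀ n i → 1 ≤ n → 2 * i ≤ suc n → r (suc n) i ≡ walkSum (rWeight n i) ∅ n
  r≡walkSum-rWeight n i 1≤n 2i≤1+n = begin
    r (suc n) i
      ≡⟨ r-unfold (suc n) i ⟩
    iverson ⌊ (B %ℕ 3) ≟ 2 ⌋ (sytℤ (A /ℕ 3) (A /ℕ 3) ((B ℤ.+ ℤ.+ 1) /ℕ 3))
      ≡⟨ cong₂ (λ X Y → iverson ⌊ (X %ℕ 3) ≟ 2 ⌋ (sytℤ (Y /ℕ 3) (Y /ℕ 3) ((X ℤ.+ ℤ.+ 1) /ℕ 3)))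
           (+m-+j≡+[m∸j] 2i≤1+n) (+m-+j≡+[m∸j] (s≤s (≤-trans 1≤n (m≤m+n n i)))) ⟩
    iverson ⌊ gap n i % 3 ≟ 2 ⌋ (syt ((suc n + i ∸ 2) / 3) ((suc n + i ∸ 2) / 3) ((gap n i + 1) / 3))
      ≡⟨ shape ⟩
    iverson ⌊ gap n i % 3 ≟ 2 ⌋ (walkSum (δ (q + i , q + i , q + 1)) ∅ n)
      ≡⟨ walkSum-iverson n ∅ ⌊ gap n i % 3 ≟ 2 ⌋ (δ (q + i , q + i , q + 1)) ⟩
    walkSum (rWeight n i) ∅ n ∎
    where
    open ≡-Reasoning
    A = ℤ.+ suc n ℤ.+ ℤ.+ i ℤ.- ℤ.+ 2
    B = ℤ.+ suc n ℤ.- ℤ.+ (2 * i)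
    q = gap n i / 3
    shape : iverson ⌊ gap n i % 3 ≟ 2 ⌋ (syt ((suc n + i ∸ 2) / 3) ((suc n + i ∸ 2) / 3) ((gap n i + 1) / 3))
          ≡ iverson ⌊ gap n i % 3 ≟ 2 ⌋ (walkSum (δ (q + i , q + i , q + 1)) ∅ n)
    shape with gap n i % 3 ≟ 2
    ... | no _ = refl
    ... | yes gap%3≡2 = begin
      syt ((suc n + i ∸ 2) / 3) ((suc n + i ∸ 2) / 3) ((gap n i + 1) / 3)
        ≡⟨ cong₂ (λ a c → syt a a c) first third ⟩
      syt (q + i) (q + i) (q + 1)
        ≡⟨ syt≡walkSum (q + i) (q + i) (q + 1) ⟩
      walkSum (δ (q + i , q + i , q + 1)) ∅ (q + i + (q + i) + (q + 1))
        ≡⟨ cong (walkSum (δ (q + i , q + i , q + 1)) ∅) size≡n ⟩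
      walkSum (δ (q + i , q + i , q + 1)) ∅ n ∎
      where
      gap≡ : gap n i ≡ 2 + q * 3
      gap≡ = trans (m≡m%n+[m/n]*n (gap n i) 3) (cong (_+ q * 3) gap%3≡2)
      1+n≡ : 2 + (q * 3 + 2 * i) ≡ suc n
      1+n≡ = trans (sym (+-assoc 2 (q * 3) (2 * i))) (trans (cong (_+ 2 * i) (sym gap≡)) (m∸n+n≡m 2i≤1+n))
      first : (suc n + i ∸ 2) / 3 ≡ q + i
      first = begin
        (suc n + i ∸ 2) / 3                ≡⟨ cong (λ m → (m + i ∸ 2) / 3) (sym 1+n≡) ⟩
        (2 + (q * 3 + 2 * i) + i ∸ 2) / 3  ≡⟨ cong (λ m → (m ∸ 2) / 3) (+-assoc 2 (q * 3 + 2 * i) i) ⟩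
        (2 + (q * 3 + 2 * i + i) ∸ 2) / 3  ≡⟨ cong (_/ 3) (m+n∸m≡n 2 (q * 3 + 2 * i + i)) ⟩
        (q * 3 + 2 * i + i) / 3            ≡⟨ cong (_/ 3) (solve 2 (λ q i → q :* con 3 :+ con 2 :* i :+ i
                                                                     := (q :+ i) :* con 3) refl q i) ⟩
        (q + i) * 3 / 3                    ≡⟨ m*n/n≡m (q + i) 3 ⟩
        q + i                              ∎
      third : (gap n i + 1) / 3 ≡ q + 1
      third = trans (cong (λ g → (g + 1) / 3) gap≡) (trans
        (cong (_/ 3) (solve 1 (λ q → con 2 :+ q :* con 3 :+ con 1 := (q :+ con 1) :* con 3) refl q))
        (m*n/n≡m (q + 1) 3))
      size≡n : q + i + (q + i) + (q + 1) ≡ n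
      size≡n = suc-injective (trans
        (solve 2 (λ q i → con 1 :+ (q :+ i :+ (q :+ i) :+ (q :+ con 1)) := con 2 :+ (q :* con 3 :+ con 2 :* i)) refl q i)
        1+n≡)

  rWeight-≢ : ∀ n i u → u ≢ (gap n i / 3 + i , gap n i / 3 + i , gap n i / 3 + 1) → rWeight n i u ≡ 0
  rWeight-≢ n i u u≢t =
    trans (cong (iverson ⌊ gap n i % 3 ≟ 2 ⌋) (δ-≢ _ u u≢t)) (iverson-0 ⌊ gap n i % 3 ≟ 2 ⌋)

  -- on (a , a , c + 1) only i = a - c contributes
  sum-rWeight≡1 : ∀ n c d → suc c + d + (suc c + d) + suc c ≡ n →
    sumBelow (λ i → rWeight n i (suc c + d , suc c + d , suc c)) (suc (suc n / 2)) ≡ 1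
  sum-rWeight≡1 n c d size≡n =
    trans (sumBelow-single (suc (suc n / 2)) (suc d) (s≤s (half-≤ (suc d) (suc n) 2[1+d]≤1+n)) others) at-d
    where
    a = suc c + d
    1+n≡ : suc n ≡ 2 * suc d + (2 + c * 3)
    1+n≡ = trans (cong suc (sym size≡n))
      (solve 2 (λ c d → con 1 :+ (con 1 :+ c :+ d :+ (con 1 :+ c :+ d) :+ (con 1 :+ c))
                     := con 2 :* (con 1 :+ d) :+ (con 2 :+ c :* con 3)) refl c d)
    2[1+d]≤1+n : 2 * suc d ≤ suc n
    2[1+d]≤1+n = subst (2 * suc d ≤_) (sym 1+n≡) (m≤m+n (2 * suc d) (2 + c * 3))
    gap≡ : gap n (suc d) ≡ 2 + c * 3
    gap≡ = trans (cong (_∸ 2 * suc d) 1+n≡) (m+n∸m≡n (2 * suc d) (2 + c * 3))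
    at-d : rWeight n (suc d) (a , a , suc c) ≡ 1
    at-d = begin
      rWeight n (suc d) (a , a , suc c)
        ≡⟨ cong (λ g → iverson ⌊ g % 3 ≟ 2 ⌋ (δ (g / 3 + suc d , g / 3 + suc d , g / 3 + 1) (a , a , suc c)))
                gap≡ ⟩
      iverson ⌊ (2 + c * 3) % 3 ≟ 2 ⌋ (δ (Q + suc d , Q + suc d , Q + 1) (a , a , suc c))
        ≡⟨ cong₂ (λ r q → iverson ⌊ r ≟ 2 ⌋ (δ (q + suc d , q + suc d , q + 1) (a , a , suc c)))
                 ([m+kn]%n≡m%n 2 c 3) ([2+q*3]/3≡q c) ⟩
      δ (c + suc d , c + suc d , c + 1) (a , a , suc c)
        ≡⟨ cong₂ (λ p q → δ (p , p , q) (a , a , suc c)) (+-suc c d) (+-comm c 1) ⟩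
      δ (a , a , suc c) (a , a , suc c)
        ≡⟨ δ-refl (a , a , suc c) ⟩
      1 ∎
      where
      open ≡-Reasoning
      Q = (2 + c * 3) / 3
    others : ∀ i → i ≢ suc d → rWeight n i (a , a , suc c) ≡ 0
    others i i≢1+d = rWeight-≢ n i (a , a , suc c) λ e →
      i≢1+d (sym (+-cancelˡ-≡ c (suc d) i (trans (+-suc c d) (trans (cong proj₁ e)
        (cong (_+ i) (sym (suc-injective (trans (cong (proj₂ ∘ proj₂) e) (+-comm _ 1)))))))))

  catalanWeight : ℕ → Shape → ℕ
  catalanWeight n u = E n * δ (n / 2 , n / 2 , 0) u

  E*catalan≡walkSum : ∀ n → E n * catalan (n / 2) ≡ walkSum (catalanWeight n) ∅ n
  E*catalan≡walkSum n = begin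
    E n * catalan h                               ≡⟨ cong (E n *_) (trans (catalan≡syt h) (syt≡walkSum h h 0)) ⟩
    E n * walkSum (δ (h , h , 0)) ∅ (h + h + 0)   ≡⟨ even ⟩
    E n * walkSum (δ (h , h , 0)) ∅ n             ≡⟨ sym (walkSum-* n ∅ (E n) (δ (h , h , 0))) ⟩
    walkSum (catalanWeight n) ∅ n                 ∎
    where
    open ≡-Reasoning
    h = n / 2
    even : E n * walkSum (δ (h , h , 0)) ∅ (h + h + 0) ≡ E n * walkSum (δ (h , h , 0)) ∅ n
    even with n % 2 ≟ 0
    ... | no _ = refl
    ... | yes n%2≡0 = cong (λ m → 1 * walkSum (δ (h , h , 0)) ∅ m) (trans
      (solve 1 (λ h → h :+ h :+ con 0 := con 0 :+ h :* con 2) refl h)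
      (trans (cong (_+ h * 2) (sym n%2≡0)) (sym (m≡m%n+[m/n]*n n 2))))

  catalanWeight-flat : ∀ a → catalanWeight (a + a + 0) (a , a , 0) ≡ 1
  catalanWeight-flat a = begin
    E (a + a + 0) * δ ((a + a + 0) / 2 , (a + a + 0) / 2 , 0) (a , a , 0)
      ≡⟨ cong₂ (λ r h → iverson ⌊ r ≟ 0 ⌋ 1 * δ (h , h , 0) (a , a , 0))
           (trans (cong (_% 2) 2a≡) (m*n%n≡0 a 2)) (trans (cong (_/ 2) 2a≡) (m*n/n≡m a 2)) ⟩
    1 * δ (a , a , 0) (a , a , 0)
      ≡⟨ trans (*-identityˡ _) (δ-refl (a , a , 0)) ⟩
    1 ∎
    where
    open ≡-Reasoning
    2a≡ : a + a + 0 ≡ a * 2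
    2a≡ = solve 1 (λ a → a :+ a :+ con 0 := a :* con 2) refl a

  sum-rWeight+catalanWeight≡col₂Blocked : ∀ n a b c → c ≤ b → a + b + c ≡ n →
    sumBelow (λ i → rWeight n i (a , b , c)) (suc (suc n / 2)) + catalanWeight n (a , b , c)
      ≡ col₂Blocked (a , b , c)
  sum-rWeight+catalanWeight≡col₂Blocked n a b c c≤b size≡n with a ≟ b
  ... | no a≢b = cong₂ _+_
    (sumBelow-zero (suc (suc n / 2)) λ i → rWeight-≢ n i (a , b , c) (a≢b ∘ first≡second))
    (trans (cong (E n *_) (δ-≢ (n / 2 , n / 2 , 0) (a , b , c) (a≢b ∘ first≡second))) (*-zeroʳ (E n)))
    where
    first≡second : ∀ {p r} → (a , b , c) ≡ (p , p , r) → a ≡ b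
    first≡second e = trans (cong proj₁ e) (sym (cong (proj₁ ∘ proj₂) e))
  sum-rWeight+catalanWeight≡col₂Blocked n a a zero _ size≡n | yes refl = begin
    sumBelow (λ i → rWeight n i (a , a , 0)) (suc (suc n / 2)) + catalanWeight n (a , a , 0)
      ≡⟨ cong (_+ catalanWeight n (a , a , 0)) (sumBelow-zero (suc (suc n / 2)) λ i →
           rWeight-≢ n i (a , a , 0) λ e → 0≢1+n (trans (cong (proj₂ ∘ proj₂) e) (+-comm (gap n i / 3) 1))) ⟩
    catalanWeight n (a , a , 0)
      ≡⟨ cong (λ m → catalanWeight m (a , a , 0)) (sym size≡n) ⟩
    catalanWeight (a + a + 0) (a , a , 0)
      ≡⟨ catalanWeight-flat a ⟩
    1 ∎
    where open ≡-Reasoning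
  sum-rWeight+catalanWeight≡col₂Blocked n a a (suc c) c≤a size≡n | yes refl with m≤n⇒∃[o]m+o≡n c≤a
  ... | d , refl = cong₂ _+_ (sum-rWeight≡1 n c d size≡n) (trans
    (cong (E n *_) (δ-≢ (n / 2 , n / 2 , 0) (suc c + d , suc c + d , suc c) λ e → 0≢1+n (sym (cong (proj₂ ∘ proj₂) e))))
    (*-zeroʳ (E n)))

  R+catalan≡walkSum-col₂Blocked : ∀ n → 1 ≤ n → R (suc n) + E n * catalan (n / 2) ≡ walkSum col₂Blocked ∅ n
  R+catalan≡walkSum-col₂Blocked n 1≤n = begin
    R (suc n) + E n * catalan (n / 2)
      ≡⟨ cong₂ _+_ (Σ≤-walkSum (suc n / 2) n ∅ (rWeight n) λ i i≤[1+n]/2 →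
                      r≡walkSum-rWeight n i 1≤n (≤-half i (suc n) i≤[1+n]/2))
                   (E*catalan≡walkSum n) ⟩
    walkSum (λ u → sumBelow (λ i → rWeight n i u) (suc (suc n / 2))) ∅ n + walkSum (catalanWeight n) ∅ n
      ≡⟨ sym (walkSum-+ n ∅ (λ u → sumBelow (λ i → rWeight n i u) (suc (suc n / 2))) (catalanWeight n)) ⟩
    walkSum (λ u → sumBelow (λ i → rWeight n i u) (suc (suc n / 2)) + catalanWeight n u) ∅ n
      ≡⟨ walkSum-cong n ∅ refl (λ { (a , b , c) valid size≡n →
           sum-rWeight+catalanWeight≡col₂Blocked n a b c (proj₁ (validShape⇒≤ valid)) size≡n }) ⟩
    walkSum col₂Blocked ∅ n ∎
    where open ≡-Reasoning

  τ₃-recurrence : ∀ m → 1 ≤ m → τ₃ (suc m) + (R (suc m) + E m * catalan (m / 2)) + β m 0 ≡ 3 * τ₃ m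
  τ₃-recurrence m 1≤m = trans
    (cong₂ (λ x y → τ₃ (suc m) + x + y) (R+catalan≡walkSum-col₂Blocked m 1≤m) (β≡walkSum-col₃Blocked m))
    (τ₃-suc+blocked≡3τ₃ m)

open Recurrence using (τ₃-recurrence)

import Data.Nat
open import Data.Nat as ℕ using (ℕ; suc; _≤_; _∸_; _/_; s≤s)
open import Data.Nat.Properties using (<⇒≤)
open import Data.Integer using (+_; _-_; _*_; _+_)
open import Data.Integer.Properties using (pos-+; pos-*)
open import Data.Integer.Solver using (module +-*-Solver)
open import Relation.Binary.PropositionalEquality using (_≡_; refl; sym; trans; cong; module ≡-Reasoning)

move-summands : ∀ T X Y B S → T ℕ.+ (X ℕ.+ Y) ℕ.+ B ≡ S → + T ≡ + S - + X - + Y - + B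
move-summands T X Y B S eq = begin
  + T
    ≡⟨ solve 4 (λ T X Y B → T := T :+ (X :+ Y) :+ B :- X :- Y :- B) refl (+ T) (+ X) (+ Y) (+ B) ⟩
  + T + (+ X + + Y) + + B - + X - + Y - + B
    ≡⟨ cong (λ z → + T + z + + B - + X - + Y - + B) (sym (pos-+ X Y)) ⟩
  + T + + (X ℕ.+ Y) + + B - + X - + Y - + B
    ≡⟨ cong (λ z → z + + B - + X - + Y - + B) (sym (pos-+ T (X ℕ.+ Y))) ⟩
  + (T ℕ.+ (X ℕ.+ Y)) + + B - + X - + Y - + B
    ≡⟨ cong (λ z → z - + X - + Y - + B) (trans (sym (pos-+ (T ℕ.+ (X ℕ.+ Y)) B)) (cong +_ eq)) ⟩
  + S - + X - + Y - + B ∎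
  where
  open ≡-Reasoning
  open +-*-Solver

theorem7 : (n : ℕ) → 3 ≤ n →
    + τ₃ n ≡ + 3 * + τ₃ (n ∸ 1) - + R n - + (E (n ∸ 1) Data.Nat.* catalan ((n ∸ 1) / 2)) - + β (n ∸ 1) 0
theorem7 (suc m) (s≤s 2≤m) = trans
  (move-summands (τ₃ (suc m)) (R (suc m)) (E m ℕ.* catalan (m / 2)) (β m 0) (3 ℕ.* τ₃ m)
    (τ₃-recurrence m (<⇒≤ 2≤m)))
  (cong (λ z → z - + R (suc m) - + (E m ℕ.* catalan (m / 2)) - + β m 0) (pos-* 3 (τ₃ m)))
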